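{- For every positive integer $k$, let $H_k$ be the graph obtained from a star $K_{1,2^k}$ with center $c$, whose leaves are labeled bijectively by the binary strings of length $k$, by adding $k$ new vertices $u_1,\dots,u_k$, where $u_i$ is adjacent exactly to the $2^{k-1}$ leaves whose label has $0$ in the $i$-th digit. Then $\textnormal{edim}(H_k)=k$ and $\textnormal{ftedim}(H_k)\ge 2^{k-1}+1$.
   Context: Graphs are finite, simple, undirected. For an edge $e=\{u,v\}$ and vertex $w$, $\textnormal{dist}(e,w)=\min(\textnormal{dist}(w,u),\textnormal{dist}(w,v))$. A set $S=\{v_1,\dots,v_k\}$ of vertices is an edge resolving set of $G$ if the vectors $(\textnormal{dist}(e,v_1),\dots,\textnormal{dist}(e,v_k))$ are pairwise distinct over all edges $e$. $\textnormal{edim}(G)$ is the minimum size of an edge resolving set; $\textnormal{ftedim}(G)$ is the minimum size of a nonempty $S\subseteq V(G)$ such that $S-\{s\}$ is an edge resolving set for every $s\in S$. -}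

module Defs where

open import Data.Nat using (ℕ; zero; suc; _≤_; _+_; _^_; _∸_)
open import Data.Bool using (Bool; true; false)
open import Data.Fin using (Fin)
open import Data.Vec using (Vec; lookup)
open import Data.List using (List; length; [])
open import Data.List.Membership.Propositional using (_∈_)
open import Data.List.Relation.Unary.Unique.Propositional using (Unique)
open import Data.Product using (Σ; ∃; _×_; _,_)
open import Data.Sum using (_⊎_)
open import Relation.Binary.PropositionalEquality using (_≡_; _≢_)
open import Relation.Nullary using (¬_)
open import Function.Bundles using (_⇔_)
open import Level using (0ℓ) renaming (suc to lsuc)

record Graph : Set₁ where
  field
    V      : Set
    Adj    : V → V → Set
    sym    : ∀ {u v} → Adj u v → Adj v u
    irrefl : ∀ {v} → ¬ Adj v v

module _ (G : Graph) where
  open Graph G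

  data Walk : V → V → ℕ → Set where
    here : ∀ {v} → Walk v v 0
    step : ∀ {u w v n} → Adj u w → Walk w v n → Walk u v (suc n)

  Dist : V → V → ℕ → Set
  Dist u v d = Walk u v d × (∀ m → Walk u v m → d ≤ m)

  -- Edges: adjacent ordered pairs, compared as unordered pairs.
  Edge : Set
  Edge = Σ V λ u → Σ V λ v → Adj u v

  SameEdge : Edge → Edge → Set
  SameEdge (u , v , _) (u' , v' , _) = (u ≡ u' × v ≡ v') ⊎ (u ≡ v' × v ≡ u')

  EDist : Edge → V → ℕ → Set
  EDist (u , v , _) w d =
      (Dist w u d × (∀ d' → Dist w v d' → d ≤ d'))
    ⊎ (Dist w v d × (∀ d' → Dist w u d' → d ≤ d'))

  ResolvesBy : (V → Set) → Set
  ResolvesBy P = ∀ (e f : Edge) →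
    (∀ w → P w → ∀ d → (EDist e w d ⇔ EDist f w d)) → SameEdge e f

  EdgeResolving : List V → Set
  EdgeResolving S = ResolvesBy (λ w → w ∈ S)

  FaultTolerantEdgeResolving : List V → Set
  FaultTolerantEdgeResolving S =
    (S ≢ []) × (∀ s → s ∈ S → ResolvesBy (λ w → w ∈ S × w ≢ s))

  EdimEq : ℕ → Set
  EdimEq n =
      (∃ λ (S : List V) → Unique S × length S ≡ n × EdgeResolving S)
    × (∀ (S : List V) → Unique S → EdgeResolving S → n ≤ length S)

  FtedimGeq : ℕ → Set
  FtedimGeq n = ∀ (S : List V) → Unique S → FaultTolerantEdgeResolving S → n ≤ length S

-- The graph H_k.  Labels are Vec Bool k; digit 0 is `false`; digit i is `lookup x i`.
data HV (k : ℕ) : Set where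
  center : HV k
  leaf   : Vec Bool k → HV k
  hub    : Fin k → HV k

data HAdj {k : ℕ} : HV k → HV k → Set where
  c-l : ∀ x → HAdj center (leaf x)
  l-c : ∀ x → HAdj (leaf x) center
  l-u : ∀ x i → lookup x i ≡ false → HAdj (leaf x) (hub i)
  u-l : ∀ x i → lookup x i ≡ false → HAdj (hub i) (leaf x)

HAdj-sym : ∀ {k} {u v : HV k} → HAdj u v → HAdj v u
HAdj-sym (c-l x) = l-c x
HAdj-sym (l-c x) = c-l x
HAdj-sym (l-u x i p) = u-l x i p
HAdj-sym (u-l x i p) = l-u x i p

HAdj-irrefl : ∀ {k} {v : HV k} → ¬ HAdj v v
HAdj-irrefl ()

H : ℕ → Graph
H k = record { V = HV k ; Adj = HAdj ; sym = HAdj-sym ; irrefl = HAdj-irrefl }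

module Submission where

-- From the hub u_i an edge is at distance 0 if it contains u_i, and otherwise at
-- distance 1 or 2 according to whether u_i is adjacent to its leaf, i.e. to the
-- i-th digit of that leaf; these readings identify every edge, so the k hubs
-- resolve H_k.  Conversely, every vertex sees the 2^k spokes {c, x} at only two
-- distinct distances, so a resolving set S separates at most 2^|S| spokes and
-- |S| ≥ k.  The spokes at 0z and 1z are seen alike by every vertex except the
-- leaves 0z, 1z and u_1, so a fault-tolerant S misses at most one of these three:
-- either u_1 ∈ S together with one leaf of each of the 2^(k-1) pairs, or S
-- contains all 2^k leaves.

open import Defs
open import Data.Nat using (ℕ; zero; suc; _≤_; _<_; _+_; _^_; _∸_; z≤n; s≤s)
open import Data.Nat.Properties
  using (≤-antisym; +-comm; +-identityʳ; <⇒≱; ≮⇒≥; <-≤-trans; n<1+n; ^-monoʳ-<)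
open import Data.Bool using (Bool; true; false)
import Data.Bool.Properties as Bool
open import Data.Fin using (Fin; zero; suc)
import Data.Fin.Properties as Fin
open import Data.Vec using (Vec; []; _∷_; lookup; replicate; head; tail)
import Data.Vec.Properties as Vec
open import Data.List using (List; []; _∷_; length; map; _++_; allFin)
import Data.List as List
open import Data.List.Properties using (length-map; length-++; length-tabulate)
open import Data.List.Membership.Propositional using (_∈_; _∉_)
open import Data.List.Membership.Propositional.Properties
  using (∈-map⁺; ∈-map⁻; ∈-++⁺ˡ; ∈-++⁺ʳ; ∈-allFin; ∈-lookup)
open import Data.List.Membership.Setoid.Properties using (index-injective)
open import Data.List.Relation.Binary.Subset.Propositional using (_⊆_)
open import Data.List.Relation.Unary.Any using (here; there)
open import Data.List.Relation.Unary.Unique.Propositional using (Unique)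
open import Data.List.Relation.Unary.AllPairs using ([]; _∷_)
import Data.List.Relation.Unary.All as All
import Data.List.Relation.Unary.Unique.Propositional.Properties as Unique
open import Data.Product using (∃-syntax; _×_; _,_; proj₁; proj₂)
open import Data.Sum using (inj₁; inj₂)
open import Data.Empty using (⊥; ⊥-elim)
open import Data.Unit using (⊤)
open import Function using (_∘_)
open import Function.Bundles using (_⇔_; mk⇔; Equivalence)
open import Function.Definitions using (Injective)
open import Relation.Binary.Definitions using (DecidableEquality)
open import Relation.Binary.PropositionalEquality
open import Relation.Nullary using (¬_; yes; no; does; contradiction)
open import Relation.Nullary.Decidable using (decidable-stable; dec-false)

module _ {A : Set} where

  lookup-injective : {xs : List A} → Unique xs → Injective _≡_ _≡_ (List.lookup xs)
  lookup-injective (_ ∷ _) {zero} {zero} _ = refl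
  lookup-injective (x∉xs ∷ _) {zero} {suc j} eq =
    contradiction eq (All.lookup x∉xs (∈-lookup j))
  lookup-injective (x∉xs ∷ _) {suc i} {zero} eq =
    contradiction (sym eq) (All.lookup x∉xs (∈-lookup i))
  lookup-injective (_ ∷ xs-unique) {suc i} {suc j} eq = cong suc (lookup-injective xs-unique eq)

  ∈-∉⇒≢ : ∀ {x y} {xs : List A} → x ∈ xs → y ∉ xs → x ≢ y
  ∈-∉⇒≢ x∈xs y∉xs refl = y∉xs x∈xs

  Unique⇒length≤ : {xs ys : List A} → Unique xs → xs ⊆ ys → length xs ≤ length ys
  Unique⇒length≤ xs-unique xs⊆ys = Fin.injective⇒≤ λ eq →
    lookup-injective xs-unique
      (index-injective (setoid A) (xs⊆ys (∈-lookup _)) (xs⊆ys (∈-lookup _)) eq)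

allVecs : ∀ n → List (Vec Bool n)
allVecs zero = [] ∷ []
allVecs (suc n) = map (false ∷_) (allVecs n) ++ map (true ∷_) (allVecs n)

∈-allVecs : ∀ {n} (x : Vec Bool n) → x ∈ allVecs n
∈-allVecs [] = here refl
∈-allVecs {suc n} (false ∷ x) = ∈-++⁺ˡ (∈-map⁺ (false ∷_) (∈-allVecs x))
∈-allVecs {suc n} (true ∷ x) =
  ∈-++⁺ʳ (map (false ∷_) (allVecs n)) (∈-map⁺ (true ∷_) (∈-allVecs x))

allVecs-unique : ∀ n → Unique (allVecs n)
allVecs-unique zero = All.[] ∷ []
allVecs-unique (suc n) =
  Unique.++⁺ (Unique.map⁺ (cong tail) (allVecs-unique n))
             (Unique.map⁺ (cong tail) (allVecs-unique n)) heads-differ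
  where
  heads-differ : ∀ {x} → ¬ (x ∈ map (false ∷_) (allVecs n) × x ∈ map (true ∷_) (allVecs n))
  heads-differ (p , q) with ∈-map⁻ (false ∷_) p | ∈-map⁻ (true ∷_) q
  ... | _ , _ , refl | _ , _ , ()

length-allVecs : ∀ n → length (allVecs n) ≡ 2 ^ n
length-allVecs zero = refl
length-allVecs (suc n) = begin
  length (map (false ∷_) (allVecs n) ++ map (true ∷_) (allVecs n))
    ≡⟨ length-++ (map (false ∷_) (allVecs n)) ⟩
  length (map (false ∷_) (allVecs n)) + length (map (true ∷_) (allVecs n))
    ≡⟨ cong₂ _+_ (length-map _ (allVecs n)) (length-map _ (allVecs n)) ⟩
  length (allVecs n) + length (allVecs n)
    ≡⟨ cong₂ _+_ (length-allVecs n) (trans (length-allVecs n) (sym (+-identityʳ (2 ^ n)))) ⟩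
  2 ^ n + (2 ^ n + 0) ∎
  where open ≡-Reasoning

vec-ext : ∀ {A : Set} {n} {x y : Vec A n} → (∀ i → lookup x i ≡ lookup y i) → x ≡ y
vec-ext {x = x} {y} pointwise =
  trans (sym (Vec.tabulate∘lookup x)) (trans (Vec.tabulate-cong pointwise) (Vec.tabulate∘lookup y))

module _ {A : Set} {n : ℕ} {f : Vec Bool n → A} (f-injective : Injective _≡_ _≡_ f)
         {ys : List A} (f∈ys : ∀ x → f x ∈ ys) where

  private
    image⊆ys : map f (allVecs n) ⊆ ys
    image⊆ys p with ∈-map⁻ f p
    ... | x , _ , refl = f∈ys x

    length-image : length (map f (allVecs n)) ≡ 2 ^ n
    length-image = trans (length-map f (allVecs n)) (length-allVecs n)

    image-unique : Unique (map f (allVecs n))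
    image-unique = Unique.map⁺ f-injective (allVecs-unique n)

  injective⇒2^n≤length : 2 ^ n ≤ length ys
  injective⇒2^n≤length = subst (_≤ length ys) length-image (Unique⇒length≤ image-unique image⊆ys)

  injective⇒2^n<length : ∀ {a} → a ∈ ys → (∀ x → f x ≢ a) → 2 ^ n < length ys
  injective⇒2^n<length {a} a∈ys a∉image =
    subst (λ l → suc l ≤ length ys) length-image
      (Unique⇒length≤ (All.tabulate a∉map ∷ image-unique) a∷image⊆ys)
    where
    a∉map : ∀ {b} → b ∈ map f (allVecs n) → a ≢ b
    a∉map p with ∈-map⁻ f p
    ... | x , _ , refl = a∉image x ∘ sym
    a∷image⊆ys : a ∷ map f (allVecs n) ⊆ ys
    a∷image⊆ys (here refl) = a∈ys
    a∷image⊆ys (there p) = image⊆ys p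

module _ (G : Graph) where
  open Graph G using (V; Adj; irrefl)

  walk-length≥1 : ∀ {u v m} → u ≢ v → Walk G u v m → 1 ≤ m
  walk-length≥1 u≢u here = contradiction refl u≢u
  walk-length≥1 _ (step _ _) = s≤s z≤n

  walk-length≥2 : ∀ {u v m} → u ≢ v → ¬ Adj u v → Walk G u v m → 2 ≤ m
  walk-length≥2 u≢u _ here = contradiction refl u≢u
  walk-length≥2 _ ¬adj (step adj here) = contradiction adj ¬adj
  walk-length≥2 _ _ (step _ (step _ _)) = s≤s (s≤s z≤n)

  Dist-refl : ∀ {v} → Dist G v v 0
  Dist-refl = here , λ _ _ → z≤n

  Dist-adjacent : ∀ {u v} → Adj u v → Dist G u v 1
  Dist-adjacent adj = step adj here , λ _ → walk-length≥1 λ { refl → irrefl adj }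

  Dist-two : ∀ {u w v} → Adj u w → Adj w v → u ≢ v → ¬ Adj u v → Dist G u v 2
  Dist-two adj₁ adj₂ u≢v ¬adj = step adj₁ (step adj₂ here) , λ _ → walk-length≥2 u≢v ¬adj

  Dist-functional : ∀ {u v d d'} → Dist G u v d → Dist G u v d' → d ≡ d'
  Dist-functional (walk , shortest) (walk' , shortest') = ≤-antisym (shortest _ walk') (shortest' _ walk)

  EDist-functional : ∀ e {w d d'} → EDist G e w d → EDist G e w d' → d ≡ d'
  EDist-functional _ (inj₁ (p , _)) (inj₁ (p' , _)) = Dist-functional p p'
  EDist-functional _ (inj₁ (p , min)) (inj₂ (p' , min')) = ≤-antisym (min _ p') (min' _ p)
  EDist-functional _ (inj₂ (p , min)) (inj₁ (p' , min')) = ≤-antisym (min _ p') (min' _ p)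
  EDist-functional _ (inj₂ (p , _)) (inj₂ (p' , _)) = Dist-functional p p'

  EDist-left : ∀ {u v w d} (adj : Adj u v) →
               Dist G w u d → (∀ m → Walk G w v m → d ≤ m) → EDist G (u , v , adj) w d
  EDist-left _ dist bound = inj₁ (dist , λ d' dist' → bound d' (proj₁ dist'))

  EDist-right : ∀ {u v w d} (adj : Adj u v) →
                Dist G w v d → (∀ m → Walk G w u m → d ≤ m) → EDist G (u , v , adj) w d
  EDist-right _ dist bound = inj₂ (dist , λ d' dist' → bound d' (proj₁ dist'))

  EDist-swap : ∀ {u v w d} (adj : Adj u v) →
               EDist G (u , v , adj) w d → EDist G (v , u , Graph.sym G adj) w d
  EDist-swap _ (inj₁ near-u) = inj₂ near-u
  EDist-swap _ (inj₂ near-v) = inj₁ near-v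

  SeesAlike : Edge G → Edge G → V → Set
  SeesAlike e f w = ∀ d → EDist G e w d ⇔ EDist G f w d

  seesAlike : ∀ e f {w d} → EDist G e w d → EDist G f w d → SeesAlike e f w
  seesAlike e f {w} de df _ = mk⇔ (λ de' → subst (EDist G f w) (EDist-functional e de de') df)
                                  (λ df' → subst (EDist G e w) (EDist-functional f df df') de)

  SeesAlike⇒≡ : ∀ e f {w d d'} → SeesAlike e f w → EDist G e w d → EDist G f w d' → d ≡ d'
  SeesAlike⇒≡ e f alike de df = EDist-functional f (Equivalence.to (alike _) de) df

  ResolvesBy-mono : ∀ {P Q : V → Set} → (∀ {w} → P w → Q w) → ResolvesBy G P → ResolvesBy G Q
  ResolvesBy-mono P⇒Q resolves e f alike = resolves e f λ w Pw → alike w (P⇒Q Pw)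

  module _ (_≟_ : DecidableEquality V) where
    open import Data.List.Membership.DecPropositional _≟_ using (_∈?_)

    fault-tolerant-without :
      ∀ {S} → FaultTolerantEdgeResolving G S → ∀ c → ResolvesBy G (λ w → w ∈ S × w ≢ c)
    fault-tolerant-without {S} (S≢[] , tolerant) c with c ∈? S
    ... | yes c∈S = tolerant c c∈S
    ... | no c∉S = ResolvesBy-mono (λ (w∈S , _) → w∈S , ∈-∉⇒≢ w∈S c∉S) (tolerant s s∈S)
      where
      member : ∀ {xs : List V} → xs ≢ [] → ∃[ x ] x ∈ xs
      member {[]} []≢[] = contradiction refl []≢[]
      member {x ∷ _} _ = x , here refl
      s = proj₁ (member S≢[])
      s∈S = proj₂ (member S≢[])

    fault-tolerant-misses-one-separator :
      ∀ {S} e f {a b c} → FaultTolerantEdgeResolving G S → ¬ SameEdge G e f →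
      (∀ w → w ≢ a → w ≢ b → w ≢ c → SeesAlike e f w) → a ∉ S → b ∉ S → ⊥
    fault-tolerant-misses-one-separator e f {c = c} tolerant e≁f alike a∉S b∉S =
      e≁f (fault-tolerant-without tolerant c e f λ w (w∈S , w≢c) →
             alike w (∈-∉⇒≢ w∈S a∉S) (∈-∉⇒≢ w∈S b∉S) w≢c)

_≟ᵥ_ : ∀ {n} → DecidableEquality (Vec Bool n)
_≟ᵥ_ = Vec.≡-dec Bool._≟_

_≟_ : ∀ {k} → DecidableEquality (HV k)
center ≟ center = yes refl
center ≟ leaf _ = no λ ()
center ≟ hub _ = no λ ()
leaf _ ≟ center = no λ ()
leaf x ≟ leaf y with x ≟ᵥ y
... | yes refl = yes refl
... | no x≢y = no λ { refl → x≢y refl }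
leaf _ ≟ hub _ = no λ ()
hub _ ≟ center = no λ ()
hub _ ≟ leaf _ = no λ ()
hub i ≟ hub j with i Fin.≟ j
... | yes refl = yes refl
... | no i≢j = no λ { refl → i≢j refl }

module _ {k : ℕ} where

  leaf-injective : Injective _≡_ _≡_ (leaf {k})
  leaf-injective refl = refl

  hub-injective : Injective _≡_ _≡_ (hub {k})
  hub-injective refl = refl

  -- The leaf 00…0 is adjacent to every hub.
  zeros : Vec Bool k
  zeros = replicate k false

  Dist-hub-center : ∀ i → Dist (H k) (hub i) center 2
  Dist-hub-center i =
    Dist-two (H k) (u-l zeros i (Vec.lookup-replicate i false)) (l-c zeros) (λ ()) λ ()

  Dist-hub-hub : ∀ {i j} → i ≢ j → Dist (H k) (hub i) (hub j) 2
  Dist-hub-hub {i} {j} i≢j =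
    Dist-two (H k) (u-l zeros i (Vec.lookup-replicate i false))
                   (l-u zeros j (Vec.lookup-replicate j false))
                   (i≢j ∘ hub-injective) λ ()

  hub-far-from-leaf : ∀ {x i m} → lookup x i ≡ true → Walk (H k) (hub i) (leaf x) m → 2 ≤ m
  hub-far-from-leaf xᵢ≡1 = walk-length≥2 (H k) (λ ()) λ where
    (u-l _ _ xᵢ≡0) → contradiction (trans (sym xᵢ≡1) xᵢ≡0) λ ()

  hubLevel : Bool → ℕ
  hubLevel false = 1
  hubLevel true = 2

  hubLevel-injective : ∀ {a b} → hubLevel a ≡ hubLevel b → a ≡ b
  hubLevel-injective {false} {false} _ = refl
  hubLevel-injective {true} {true} _ = refl

  hubLevel≢0 : ∀ b → hubLevel b ≢ 0
  hubLevel≢0 false ()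
  hubLevel≢0 true ()

  spoke : Vec Bool k → Edge (H k)
  spoke x = center , leaf x , c-l x

  spoke-injective : ∀ {x y} → SameEdge (H k) (spoke x) (spoke y) → x ≡ y
  spoke-injective (inj₁ (_ , same-leaf)) = leaf-injective same-leaf
  spoke-injective (inj₂ (() , _))

  -- Each vertex w reads one bit off the spoke {c, x}; its distance to the spoke
  -- depends only on that bit.
  spokeBit : HV k → Vec Bool k → Bool
  spokeBit center _ = false
  spokeBit (leaf y) x = does (x ≟ᵥ y)
  spokeBit (hub i) x = lookup x i

  spokeLevel : HV k → Bool → ℕ
  spokeLevel center _ = 0
  spokeLevel (leaf _) true = 0
  spokeLevel (leaf _) false = 1
  spokeLevel (hub _) b = hubLevel b

  EDist-spoke : ∀ w x → EDist (H k) (spoke x) w (spokeLevel w (spokeBit w x))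
  EDist-spoke center x = EDist-left (H k) (c-l x) (Dist-refl (H k)) λ _ _ → z≤n
  EDist-spoke (leaf y) x with x ≟ᵥ y
  ... | yes refl = EDist-right (H k) (c-l x) (Dist-refl (H k)) λ _ _ → z≤n
  ... | no x≢y = EDist-left (H k) (c-l x) (Dist-adjacent (H k) (l-c y))
                   λ _ → walk-length≥1 (H k) (x≢y ∘ sym ∘ leaf-injective)
  EDist-spoke (hub i) x with lookup x i in xᵢ
  ... | false = EDist-right (H k) (c-l x) (Dist-adjacent (H k) (u-l x i xᵢ))
                  λ _ → walk-length≥1 (H k) λ ()
  ... | true = EDist-left (H k) (c-l x) (Dist-hub-center i) λ _ → hub-far-from-leaf xᵢ

  spokes-alike : ∀ {w x y} → spokeBit w x ≡ spokeBit w y → SeesAlike (H k) (spoke x) (spoke y) w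
  spokes-alike {w} {x} {y} same-bit =
    seesAlike (H k) (spoke x) (spoke y) (EDist-spoke w x)
      (subst (EDist (H k) (spoke y) w) (cong (spokeLevel w) (sym same-bit)) (EDist-spoke w y))

  signature : (S : List (HV k)) → Vec Bool k → Vec Bool (length S)
  signature [] _ = []
  signature (w ∷ S) x = spokeBit w x ∷ signature S x

  signature-spokeBit :
    ∀ S {x y w} → signature S x ≡ signature S y → w ∈ S → spokeBit w x ≡ spokeBit w y
  signature-spokeBit (_ ∷ _) same (here refl) = cong head same
  signature-spokeBit (_ ∷ S) same (there w∈S) = signature-spokeBit S (cong tail same) w∈S

  signature-injective : ∀ {S} → EdgeResolving (H k) S → Injective _≡_ _≡_ (signature S)
  signature-injective {S} resolving same =
    spoke-injective (resolving (spoke _) (spoke _) λ _ w∈S →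
      spokes-alike (signature-spokeBit S same w∈S))

  edim-lower : ∀ {S} → EdgeResolving (H k) S → k ≤ length S
  edim-lower {S} resolving = ≮⇒≥ λ |S|<k →
    <⇒≱ (^-monoʳ-< 2 (s≤s (s≤s z≤n)) |S|<k)
        (subst (2 ^ k ≤_) (length-allVecs (length S))
          (injective⇒2^n≤length (signature-injective resolving) (∈-allVecs ∘ signature S)))

  -- Edges up to orientation: spokes {c, x} and links {x, u_j}.
  data Shape : Set where
    spokeShape : Vec Bool k → Shape
    linkShape : Vec Bool k → Fin k → Shape

  shape : Edge (H k) → Shape
  shape (_ , _ , c-l x) = spokeShape x
  shape (_ , _ , l-c x) = spokeShape x
  shape (_ , _ , l-u x j _) = linkShape x j
  shape (_ , _ , u-l x j _) = linkShape x j

  ValidShape : Shape → Set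
  ValidShape (spokeShape _) = ⊤
  ValidShape (linkShape x j) = lookup x j ≡ false

  shape-valid : ∀ e → ValidShape (shape e)
  shape-valid (_ , _ , c-l _) = _
  shape-valid (_ , _ , l-c _) = _
  shape-valid (_ , _ , l-u _ _ xⱼ) = xⱼ
  shape-valid (_ , _ , u-l _ _ xⱼ) = xⱼ

  shape-injective : ∀ e f → shape e ≡ shape f → SameEdge (H k) e f
  shape-injective (_ , _ , c-l _) (_ , _ , c-l _) refl = inj₁ (refl , refl)
  shape-injective (_ , _ , c-l _) (_ , _ , l-c _) refl = inj₂ (refl , refl)
  shape-injective (_ , _ , l-c _) (_ , _ , c-l _) refl = inj₂ (refl , refl)
  shape-injective (_ , _ , l-c _) (_ , _ , l-c _) refl = inj₁ (refl , refl)
  shape-injective (_ , _ , l-u _ _ _) (_ , _ , l-u _ _ _) refl = inj₁ (refl , refl)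
  shape-injective (_ , _ , l-u _ _ _) (_ , _ , u-l _ _ _) refl = inj₂ (refl , refl)
  shape-injective (_ , _ , u-l _ _ _) (_ , _ , l-u _ _ _) refl = inj₂ (refl , refl)
  shape-injective (_ , _ , u-l _ _ _) (_ , _ , u-l _ _ _) refl = inj₁ (refl , refl)
  shape-injective (_ , _ , c-l _) (_ , _ , l-u _ _ _) ()
  shape-injective (_ , _ , c-l _) (_ , _ , u-l _ _ _) ()
  shape-injective (_ , _ , l-c _) (_ , _ , l-u _ _ _) ()
  shape-injective (_ , _ , l-c _) (_ , _ , u-l _ _ _) ()
  shape-injective (_ , _ , l-u _ _ _) (_ , _ , c-l _) ()
  shape-injective (_ , _ , l-u _ _ _) (_ , _ , l-c _) ()
  shape-injective (_ , _ , u-l _ _ _) (_ , _ , c-l _) ()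
  shape-injective (_ , _ , u-l _ _ _) (_ , _ , l-c _) ()

  hubCode : Shape → Fin k → ℕ
  hubCode (spokeShape x) i = hubLevel (lookup x i)
  hubCode (linkShape x j) i with i Fin.≟ j
  ... | yes _ = 0
  ... | no _ = hubLevel (lookup x i)

  hubCode-link-self : ∀ x j → hubCode (linkShape x j) j ≡ 0
  hubCode-link-self x j with j Fin.≟ j
  ... | yes _ = refl
  ... | no j≢j = contradiction refl j≢j

  hubCode-link-other : ∀ x {i j} → i ≢ j → hubCode (linkShape x j) i ≡ hubLevel (lookup x i)
  hubCode-link-other x {i} {j} i≢j with i Fin.≟ j
  ... | yes i≡j = contradiction i≡j i≢j
  ... | no _ = refl

  EDist-link : ∀ x j (xⱼ : lookup x j ≡ false) i →
               EDist (H k) (leaf x , hub j , l-u x j xⱼ) (hub i) (hubCode (linkShape x j) i)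
  EDist-link x j xⱼ i with i Fin.≟ j
  ... | yes refl = EDist-right (H k) (l-u x j xⱼ) (Dist-refl (H k)) λ _ _ → z≤n
  ... | no i≢j with lookup x i in xᵢ
  ...   | false = EDist-left (H k) (l-u x j xⱼ) (Dist-adjacent (H k) (u-l x i xᵢ))
                    λ _ → walk-length≥1 (H k) (i≢j ∘ hub-injective)
  ...   | true = EDist-right (H k) (l-u x j xⱼ) (Dist-hub-hub i≢j) λ _ → hub-far-from-leaf xᵢ

  EDist-hubCode : ∀ e i → EDist (H k) e (hub i) (hubCode (shape e) i)
  EDist-hubCode (_ , _ , c-l x) i = EDist-spoke (hub i) x
  EDist-hubCode (_ , _ , l-c x) i = EDist-swap (H k) (c-l x) (EDist-spoke (hub i) x)
  EDist-hubCode (_ , _ , l-u x j xⱼ) i = EDist-link x j xⱼ i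
  EDist-hubCode (_ , _ , u-l x j xⱼ) i = EDist-swap (H k) (l-u x j xⱼ) (EDist-link x j xⱼ i)

  hubCode-injective :
    ∀ s t → ValidShape s → ValidShape t → (∀ i → hubCode s i ≡ hubCode t i) → s ≡ t
  hubCode-injective (spokeShape x) (spokeShape y) _ _ same =
    cong spokeShape (vec-ext λ i → hubLevel-injective (same i))
  hubCode-injective (spokeShape x) (linkShape y j) _ _ same =
    contradiction (trans (same j) (hubCode-link-self y j)) (hubLevel≢0 _)
  hubCode-injective (linkShape x j) (spokeShape y) _ _ same =
    contradiction (trans (sym (same j)) (hubCode-link-self x j)) (hubLevel≢0 _)
  hubCode-injective (linkShape x j) (linkShape y j') xⱼ yⱼ' same with j Fin.≟ j'
  ... | no j≢j' =
    contradiction (trans (sym (hubCode-link-other y j≢j')) (trans (sym (same j)) (hubCode-link-self x j)))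
                  (hubLevel≢0 _)
  ... | yes refl = cong (λ z → linkShape z j) (vec-ext agree)
    where
    agree : ∀ i → lookup x i ≡ lookup y i
    agree i with i Fin.≟ j
    ... | yes refl = trans xⱼ (sym yⱼ')
    ... | no i≢j = hubLevel-injective
      (trans (sym (hubCode-link-other x i≢j)) (trans (same i) (hubCode-link-other y i≢j)))

  hubs : List (HV k)
  hubs = map hub (allFin k)

  hubs-unique : Unique hubs
  hubs-unique = Unique.map⁺ hub-injective (Unique.allFin⁺ k)

  length-hubs : length hubs ≡ k
  length-hubs = trans (length-map hub (allFin k)) (length-tabulate (λ i → i))

  hubs-resolve : EdgeResolving (H k) hubs
  hubs-resolve e f alike = shape-injective e f
    (hubCode-injective _ _ (shape-valid e) (shape-valid f) λ i →
      SeesAlike⇒≡ (H k) e f (alike (hub i) (∈-map⁺ hub (∈-allFin i)))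
        (EDist-hubCode e i) (EDist-hubCode f i))

module _ {m : ℕ} {S : List (HV (suc m))} (fault-tolerant : FaultTolerantEdgeResolving (H (suc m)) S) where
  open import Data.List.Membership.DecPropositional (_≟_ {suc m}) using (_∈?_)

  twins-alike : ∀ z w → w ≢ leaf (false ∷ z) → w ≢ leaf (true ∷ z) → w ≢ hub zero →
                SeesAlike (H (suc m)) (spoke (false ∷ z)) (spoke (true ∷ z)) w
  twins-alike z w w≢0z w≢1z w≢u₀ = spokes-alike (same-bit w w≢0z w≢1z w≢u₀)
    where
    same-bit : ∀ w → w ≢ leaf (false ∷ z) → w ≢ leaf (true ∷ z) → w ≢ hub zero →
               spokeBit w (false ∷ z) ≡ spokeBit w (true ∷ z)
    same-bit center _ _ _ = refl
    same-bit (leaf y) w≢0z w≢1z _ =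
      trans (dec-false (_ ≟ᵥ y) (w≢0z ∘ cong leaf ∘ sym))
            (sym (dec-false (_ ≟ᵥ y) (w≢1z ∘ cong leaf ∘ sym)))
    same-bit (hub zero) _ _ w≢u₀ = contradiction refl w≢u₀
    same-bit (hub (suc _)) _ _ _ = refl

  twins-differ : ∀ z → ¬ SameEdge (H (suc m)) (spoke (false ∷ z)) (spoke (true ∷ z))
  twins-differ z same with cong head (spoke-injective same)
  ... | ()

  twins-need-separator :
    ∀ z {a b c} →
    (∀ w → w ≢ a → w ≢ b → w ≢ c → SeesAlike (H (suc m)) (spoke (false ∷ z)) (spoke (true ∷ z)) w) →
    a ∉ S → b ∉ S → ⊥
  twins-need-separator z =
    fault-tolerant-misses-one-separator (H (suc m)) _≟_ (spoke (false ∷ z)) (spoke (true ∷ z))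
      fault-tolerant (twins-differ z)

  some-twin∈ : ∀ z → ∃[ b ] leaf (b ∷ z) ∈ S
  some-twin∈ z with leaf (false ∷ z) ∈? S | leaf (true ∷ z) ∈? S
  ... | yes 0z∈S | _ = false , 0z∈S
  ... | no _ | yes 1z∈S = true , 1z∈S
  ... | no 0z∉S | no 1z∉S = ⊥-elim (twins-need-separator z (twins-alike z) 0z∉S 1z∉S)

  chosen-twin : Vec Bool m → HV (suc m)
  chosen-twin z = leaf (proj₁ (some-twin∈ z) ∷ z)

  all-leaves∈ : hub zero ∉ S → ∀ x → leaf x ∈ S
  all-leaves∈ u₀∉S (false ∷ z) = decidable-stable (_ ∈? S)
    (twins-need-separator z (λ w w≢u₀ w≢0z w≢1z → twins-alike z w w≢0z w≢1z w≢u₀) u₀∉S)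
  all-leaves∈ u₀∉S (true ∷ z) = decidable-stable (_ ∈? S)
    (twins-need-separator z (λ w w≢u₀ w≢1z w≢0z → twins-alike z w w≢0z w≢1z w≢u₀) u₀∉S)

  ftedim-lower : 2 ^ m + 1 ≤ length S
  ftedim-lower = subst (_≤ length S) (+-comm 1 (2 ^ m)) 2^m<|S|
    where
    2^m<|S| : 2 ^ m < length S
    2^m<|S| with hub zero ∈? S
    ... | yes u₀∈S =
      injective⇒2^n<length {f = chosen-twin} (cong tail ∘ leaf-injective) (proj₂ ∘ some-twin∈) u₀∈S λ _ ()
    ... | no u₀∉S =
      <-≤-trans (^-monoʳ-< 2 (s≤s (s≤s z≤n)) (n<1+n m))
                (injective⇒2^n≤length leaf-injective (all-leaves∈ u₀∉S))

theorem12 : (k : ℕ) → 1 ≤ k → EdimEq (H k) k × FtedimGeq (H k) (2 ^ (k ∸ 1) + 1)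
theorem12 (suc m) _ =
  ((hubs , hubs-unique , length-hubs , hubs-resolve) , λ _ _ → edim-lower) , λ _ _ → ftedim-lower
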